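{- Let $H$ be a graph and $n\ge1$. The clique corona $H\circ K_n$ is a König–Egerváry graph with a perfect matching if and only if $n=1$.
   Context: All graphs are finite, simple and undirected. A graph $G$ is König–Egerváry if $\alpha(G)+\mu(G)=n(G)$, where $\alpha$ is the independence number, $\mu$ the maximum matching size and $n(G)$ the number of vertices. The corona $H\circ X$ is obtained from $H$ by taking, for each vertex $v$ of $H$, a disjoint copy of $X$ and joining $v$ to all vertices of that copy. -}

module Defs where

open import Data.Nat using (ℕ; _+_; _*_; _≤_)
open import Data.Fin using (Fin; splitAt; remQuot)
open import Data.Product using (Σ; _×_; _,_; proj₁; proj₂; ∃-syntax)
open import Data.Sum using (_⊎_; inj₁; inj₂)
open import Data.Empty using (⊥)
open import Data.List using (List; []; _∷_; length; concatMap)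
open import Data.List.Relation.Unary.All using (All)
open import Data.List.Relation.Unary.Unique.Propositional using (Unique)
open import Data.List.Membership.Propositional using (_∈_)
open import Relation.Nullary using (¬_)
open import Relation.Binary.PropositionalEquality using (_≡_; _≢_; refl; sym)

record Graph : Set₁ where
  field
    V     : ℕ
    Adj   : Fin V → Fin V → Set
    adj-sym : ∀ {u v} → Adj u v → Adj v u
    adj-irr : ∀ {u} → ¬ Adj u u
open Graph public

K : ℕ → Graph
K n = record { V = n ; Adj = λ i j → i ≢ j ; adj-sym = λ p q → p (sym q) ; adj-irr = λ p → p refl }

-- Corona H ∘ X.  Vertex set Fin (V H + V H * V X): the first V H vertices are
-- the vertices of H, the remaining ones encode pairs (v , x) = vertex x of the
-- copy of X attached to v.
CVert : Graph → Graph → Set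
CVert H X = Fin (V H) ⊎ (Fin (V H) × Fin (V X))

decode : (H X : Graph) → Fin (V H + V H * V X) → CVert H X
decode H X i with splitAt (V H) i
... | inj₁ u = inj₁ u
... | inj₂ j = inj₂ (remQuot (V X) j)

CAdj : (H X : Graph) → CVert H X → CVert H X → Set
CAdj H X (inj₁ u) (inj₁ v) = Adj H u v
CAdj H X (inj₁ u) (inj₂ (w , x)) = u ≡ w
CAdj H X (inj₂ (w , x)) (inj₁ u) = w ≡ u
CAdj H X (inj₂ (w , x)) (inj₂ (w' , y)) = (w ≡ w') × Adj X x y

CAdj-sym : (H X : Graph) → ∀ a b → CAdj H X a b → CAdj H X b a
CAdj-sym H X (inj₁ u) (inj₁ v) p = adj-sym H p
CAdj-sym H X (inj₁ u) (inj₂ _) p = sym p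
CAdj-sym H X (inj₂ _) (inj₁ u) p = sym p
CAdj-sym H X (inj₂ _) (inj₂ _) (p , q) = sym p , adj-sym X q

CAdj-irr : (H X : Graph) → ∀ a → ¬ CAdj H X a a
CAdj-irr H X (inj₁ u) p = adj-irr H p
CAdj-irr H X (inj₂ _) (_ , q) = adj-irr X q

corona : Graph → Graph → Graph
corona H X = record
  { V = V H + V H * V X
  ; Adj = λ i j → CAdj H X (decode H X i) (decode H X j)
  ; adj-sym = λ {i} {j} → CAdj-sym H X (decode H X i) (decode H X j)
  ; adj-irr = λ {i} → CAdj-irr H X (decode H X i)
  }

IsIndependent : (G : Graph) → List (Fin (V G)) → Set
IsIndependent G S = Unique S × (∀ {u v} → u ∈ S → v ∈ S → ¬ Adj G u v)

IsIndependenceNumber : (G : Graph) → ℕ → Set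
IsIndependenceNumber G a =
  (∃[ S ] (IsIndependent G S × length S ≡ a)) ×
  (∀ S → IsIndependent G S → length S ≤ a)

endpoints : {A : Set} → List (A × A) → List A
endpoints = concatMap (λ e → proj₁ e ∷ proj₂ e ∷ [])

IsMatching : (G : Graph) → List (Fin (V G) × Fin (V G)) → Set
IsMatching G M = All (λ e → Adj G (proj₁ e) (proj₂ e)) M × Unique (endpoints M)

IsMatchingNumber : (G : Graph) → ℕ → Set
IsMatchingNumber G m =
  (∃[ M ] (IsMatching G M × length M ≡ m)) ×
  (∀ M → IsMatching G M → length M ≤ m)

IsKoenigEgervary : Graph → Set
IsKoenigEgervary G =
  ∃[ a ] ∃[ m ] (IsIndependenceNumber G a × IsMatchingNumber G m × a + m ≡ V G)

HasPerfectMatching : Graph → Set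
HasPerfectMatching G = ∃[ M ] (IsMatching G M × (∀ v → v ∈ endpoints M))

-- Every vertex of H ∘ K_n lies in one of the h = |V H| cliques {v} ∪ (copy of K_n at v), and an
-- independent set meets each clique at most once, so α ≤ h; trivially 2μ ≤ h + hn. Hence
-- α + μ = h + hn forces μ ≤ α ≤ h and then hn ≤ h, i.e. n = 1. For n = 1 the h pendant vertices are independent and the h pendant
-- edges form a perfect matching, so α = μ = h and α + μ = 2h = |V (H ∘ K_1)|.
module Submission where

open import Defs
open import Data.Nat using (ℕ; suc; _≤_; _<_; _+_; _*_; >-nonZero)
open import Data.Nat.Properties
  using ( ≤-trans; ≤-reflexive; ≤-antisym; ≮⇒≥; <⇒≱; +-suc; +-mono-<; +-mono-≤; +-monoʳ-≤
        ; +-cancelˡ-≤; +-cancelʳ-≤; *-cancelˡ-≤; *-identityʳ; module ≤-Reasoning)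
open import Data.Product using (_×_; _,_; proj₁; proj₂; <_,_>)
open import Data.Sum using (inj₁; inj₂)
open import Data.Empty using (⊥-elim)
open import Function using (_∘_; case_of_)
open import Function.Bundles using (_⇔_; mk⇔)
open import Relation.Nullary using (¬_)
open import Relation.Binary.PropositionalEquality
  using (_≡_; _≢_; refl; sym; trans; cong; cong₂; subst; subst₂)
open import Data.Fin using (Fin; splitAt; combine; _↑ˡ_; _↑ʳ_) renaming (zero to fzero; suc to fsuc)
open import Data.Fin.Properties
  using (splitAt-↑ˡ; splitAt-↑ʳ; splitAt⁻¹-↑ˡ; splitAt⁻¹-↑ʳ; remQuot-combine; combine-remQuot; injective⇒≤)
open import Data.List using (List; []; _∷_; length; map; concat; concatMap; allFin; lookup)
open import Data.List.Properties using (length-map; length-tabulate; map-∘)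
open import Data.List.Relation.Unary.All as All using (All; []; _∷_)
import Data.List.Relation.Unary.All.Properties as All
open import Data.List.Relation.Unary.AllPairs as AllPairs using (AllPairs; []; _∷_)
import Data.List.Relation.Unary.AllPairs.Properties as AllPairs
open import Data.List.Relation.Unary.Unique.Propositional using (Unique)
import Data.List.Relation.Unary.Unique.Propositional.Properties as Unique
open import Data.List.Relation.Unary.Any using (here; there)
open import Data.List.Relation.Binary.Disjoint.Propositional using (Disjoint)
open import Data.List.Membership.Propositional using (_∈_)
open import Data.List.Membership.Propositional.Properties
  using (∈-map⁺; ∈-map⁻; ∈-lookup; ∈-allFin; ∈-concat⁺′)

m+m≤n+n⇒m≤n : ∀ {m n} → m + m ≤ n + n → m ≤ n
m+m≤n+n⇒m≤n le = ≮⇒≥ (λ n<m → <⇒≱ (+-mono-< n<m n<m) le)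

length-allFin : ∀ k → length (allFin k) ≡ k
length-allFin k = length-tabulate (λ i → i)

lookup-injective : ∀ {A : Set} {xs : List A} → Unique xs →
  ∀ {i j} → lookup xs i ≡ lookup xs j → i ≡ j
lookup-injective {xs = _ ∷ _} _          {fzero}  {fzero}  _ = refl
lookup-injective {xs = _ ∷ _} (x∉xs ∷ _) {fzero}  {fsuc j} x≡xⱼ =
  ⊥-elim (All.lookup x∉xs (∈-lookup j) x≡xⱼ)
lookup-injective {xs = _ ∷ _} (x∉xs ∷ _) {fsuc i} {fzero}  xᵢ≡x =
  ⊥-elim (All.lookup x∉xs (∈-lookup i) (sym xᵢ≡x))
lookup-injective {xs = _ ∷ _} (_ ∷ xs!)  {fsuc i} {fsuc j} xᵢ≡xⱼ =
  cong fsuc (lookup-injective xs! xᵢ≡xⱼ)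

unique⇒length≤ : ∀ {k} {xs : List (Fin k)} → Unique xs → length xs ≤ k
unique⇒length≤ xs! = injective⇒≤ (lookup-injective xs!)

length-endpoints : ∀ {A : Set} (M : List (A × A)) → length (endpoints M) ≡ length M + length M
length-endpoints [] = refl
length-endpoints (_ ∷ M) =
  cong suc (trans (cong suc (length-endpoints M)) (sym (+-suc (length M) (length M))))

module _ {A B : Set} (f g : A → B) where

  private
    pair : A → List B
    pair x = f x ∷ g x ∷ []

    endpoints-map : ∀ xs → endpoints (map < f , g > xs) ≡ concatMap pair xs
    endpoints-map xs = cong concat (sym (map-∘ xs))

  ∈-endpoints-map : ∀ {x xs} → x ∈ xs →
    f x ∈ endpoints (map < f , g > xs) × g x ∈ endpoints (map < f , g > xs)
  ∈-endpoints-map {x} {xs} x∈xs rewrite endpoints-map xs =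
    ∈-concat⁺′ (here refl) pair∈ , ∈-concat⁺′ (there (here refl)) pair∈
    where
    pair∈ : pair x ∈ map pair xs
    pair∈ = ∈-map⁺ pair x∈xs

  unique-endpoints-map :
    (∀ {x y} → f x ≡ f y → x ≡ y) → (∀ {x y} → g x ≡ g y → x ≡ y) → (∀ x y → f x ≢ g y) →
    ∀ {xs} → Unique xs → Unique (endpoints (map < f , g > xs))
  unique-endpoints-map f-injective g-injective f≢g {xs} xs! rewrite endpoints-map xs =
    Unique.concat⁺ (All.map⁺ (All.universal (λ x → (f≢g x x ∷ []) ∷ [] ∷ []) xs))
                   (AllPairs.map⁺ (AllPairs.map pair-disjoint xs!))
    where
    pair-disjoint : ∀ {x y} → x ≢ y → Disjoint (pair x) (pair y)
    pair-disjoint x≢y (here refl         , here fx≡fy)         = x≢y (f-injective fx≡fy)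
    pair-disjoint x≢y (here refl         , there (here fx≡gy)) = f≢g _ _ fx≡gy
    pair-disjoint x≢y (there (here refl) , here gx≡fy)         = f≢g _ _ (sym gx≡fy)
    pair-disjoint x≢y (there (here refl) , there (here gx≡gy)) = x≢y (g-injective gx≡gy)

IsCliqueCover : (G : Graph) {k : ℕ} → (Fin (V G) → Fin k) → Set
IsCliqueCover G f = ∀ {u v} → f u ≡ f v → u ≢ v → Adj G u v

module _ (G : Graph) where

  independent⇒AllPairs : ∀ {S} → IsIndependent G S → AllPairs (λ u v → u ≢ v × ¬ Adj G u v) S
  independent⇒AllPairs {S = []} _ = []
  independent⇒AllPairs {S = _ ∷ _} (u∉S ∷ S! , indep) =
    All.tabulate (λ v∈S → All.lookup u∉S v∈S , indep (here refl) (there v∈S))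
    ∷ independent⇒AllPairs (S! , λ u∈S v∈S → indep (there u∈S) (there v∈S))

  independent-length≤ : ∀ {k S} {f : Fin (V G) → Fin k} →
    IsCliqueCover G f → IsIndependent G S → length S ≤ k
  independent-length≤ {k} {S} {f} cover indep = begin
    length S         ≡⟨ sym (length-map f S) ⟩
    length (map f S) ≤⟨ unique⇒length≤ f[S]! ⟩
    k                ∎
    where
    open ≤-Reasoning
    separated : ∀ {u v} → u ≢ v × ¬ Adj G u v → f u ≢ f v
    separated (u≢v , ¬adj) fu≡fv = ¬adj (cover fu≡fv u≢v)
    f[S]! : Unique (map f S)
    f[S]! = AllPairs.map⁺ (AllPairs.map separated (independent⇒AllPairs indep))

  matching-length : ∀ {M} → IsMatching G M → length M + length M ≤ V G
  matching-length {M} (_ , ends!) =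
    ≤-trans (≤-reflexive (sym (length-endpoints M))) (unique⇒length≤ ends!)

  isIndependenceNumber : ∀ {k S} {f : Fin (V G) → Fin k} → IsCliqueCover G f →
    IsIndependent G S → length S ≡ k → IsIndependenceNumber G k
  isIndependenceNumber cover indep refl =
    (_ , indep , refl) , λ _ → independent-length≤ cover

  isMatchingNumber : ∀ {M} → IsMatching G M →
    length M + length M ≡ V G → IsMatchingNumber G (length M)
  isMatchingNumber matching 2|M|≡n =
    (_ , matching , refl) ,
    λ _ matching′ → m+m≤n+n⇒m≤n (≤-trans (matching-length matching′) (≤-reflexive (sym 2|M|≡n)))

  koenigEgervary⇒order≤2k : ∀ {k} {f : Fin (V G) → Fin k} →
    IsCliqueCover G f → IsKoenigEgervary G → V G ≤ k + k
  koenigEgervary⇒order≤2k {k} cover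
    (a , m , ((_ , indep , refl) , _) , ((_ , matching , refl) , _) , a+m≡n) = begin
    V G   ≡⟨ sym a+m≡n ⟩
    a + m ≤⟨ +-monoʳ-≤ a m≤a ⟩
    a + a ≤⟨ +-mono-≤ a≤k a≤k ⟩
    k + k ∎
    where
    open ≤-Reasoning
    a≤k : a ≤ k
    a≤k = independent-length≤ cover indep
    m≤a : m ≤ a
    m≤a = +-cancelʳ-≤ m m a (≤-trans (matching-length matching) (≤-reflexive (sym a+m≡n)))

module _ (H X : Graph) where

  encode : CVert H X → Fin (V (corona H X))
  encode (inj₁ u)       = u ↑ˡ (V H * V X)
  encode (inj₂ (w , x)) = V H ↑ʳ combine w x

  decode-encode : ∀ c → decode H X (encode c) ≡ c
  decode-encode (inj₁ u) rewrite splitAt-↑ˡ (V H) u (V H * V X) = refl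
  decode-encode (inj₂ (w , x))
    rewrite splitAt-↑ʳ (V H) (V H * V X) (combine w x) | remQuot-combine {V H} {V X} w x = refl

  encode-decode : ∀ i → encode (decode H X i) ≡ i
  encode-decode i with splitAt (V H) i in eq
  ... | inj₁ u = splitAt⁻¹-↑ˡ eq
  ... | inj₂ j = trans (cong (V H ↑ʳ_) (combine-remQuot {V H} (V X) j)) (splitAt⁻¹-↑ʳ eq)

  encode-injective : ∀ {c d} → encode c ≡ encode d → c ≡ d
  encode-injective {c} {d} eq =
    trans (sym (decode-encode c)) (trans (cong (decode H X) eq) (decode-encode d))

  decode-injective : ∀ {i j} → decode H X i ≡ decode H X j → i ≡ j
  decode-injective {i} {j} eq =
    trans (sym (encode-decode i)) (trans (cong encode eq) (encode-decode j))

  CAdj⇒Adj-encode : ∀ {c d} → CAdj H X c d → Adj (corona H X) (encode c) (encode d)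
  CAdj⇒Adj-encode {c} {d} = subst₂ (CAdj H X) (sym (decode-encode c)) (sym (decode-encode d))

  Adj-encode⇒CAdj : ∀ {c d} → Adj (corona H X) (encode c) (encode d) → CAdj H X c d
  Adj-encode⇒CAdj {c} {d} = subst₂ (CAdj H X) (decode-encode c) (decode-encode d)

  owner : CVert H X → Fin (V H)
  owner (inj₁ u)       = u
  owner (inj₂ (w , _)) = w

  hub : Fin (V H) → Fin (V (corona H X))
  hub v = encode (inj₁ v)

  pendant : Fin (V X) → Fin (V H) → Fin (V (corona H X))
  pendant x₀ v = encode (inj₂ (v , x₀))

  hub-injective : ∀ {u v} → hub u ≡ hub v → u ≡ v
  hub-injective {u} {v} = cong owner ∘ encode-injective {inj₁ u} {inj₁ v}

  pendant-injective : ∀ {x₀ u v} → pendant x₀ u ≡ pendant x₀ v → u ≡ v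
  pendant-injective {x₀} {u} {v} = cong owner ∘ encode-injective {inj₂ (u , x₀)} {inj₂ (v , x₀)}

  hub≢pendant : ∀ {x₀} u v → hub u ≢ pendant x₀ v
  hub≢pendant {x₀} u v eq = case encode-injective {inj₁ u} {inj₂ (v , x₀)} eq of λ ()

  pendants : Fin (V X) → List (Fin (V (corona H X)))
  pendants x₀ = map (pendant x₀) (allFin (V H))

  pendants-independent : ∀ x₀ → IsIndependent (corona H X) (pendants x₀)
  pendants-independent x₀ = Unique.map⁺ pendant-injective (Unique.allFin⁺ (V H)) , independent
    where
    independent : ∀ {u v} → u ∈ pendants x₀ → v ∈ pendants x₀ → ¬ Adj (corona H X) u v
    independent u∈ v∈ adj with ∈-map⁻ _ u∈ | ∈-map⁻ _ v∈
    ... | a , _ , refl | b , _ , refl =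
      adj-irr X (proj₂ (Adj-encode⇒CAdj {inj₂ (a , x₀)} {inj₂ (b , x₀)} adj))

  length-pendants : ∀ x₀ → length (pendants x₀) ≡ V H
  length-pendants x₀ = trans (length-map _ (allFin (V H))) (length-allFin (V H))

  pendantMatching : Fin (V X) → List (Fin (V (corona H X)) × Fin (V (corona H X)))
  pendantMatching x₀ = map < hub , pendant x₀ > (allFin (V H))

  pendantMatching-isMatching : ∀ x₀ → IsMatching (corona H X) (pendantMatching x₀)
  pendantMatching-isMatching x₀ =
    All.map⁺ (All.universal (λ v → CAdj⇒Adj-encode {inj₁ v} {inj₂ (v , x₀)} refl) (allFin (V H))) ,
    unique-endpoints-map hub (pendant x₀) hub-injective pendant-injective hub≢pendant
      (Unique.allFin⁺ (V H))

  length-pendantMatching : ∀ x₀ → length (pendantMatching x₀) ≡ V H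
  length-pendantMatching x₀ = trans (length-map _ (allFin (V H))) (length-allFin (V H))

  pendantMatching-perfect : ∀ {x₀} → (∀ x → x ≡ x₀) → ∀ i → i ∈ endpoints (pendantMatching x₀)
  pendantMatching-perfect {x₀} only i =
    subst (_∈ endpoints (pendantMatching x₀)) (encode-decode i) (covered (decode H X i))
    where
    covered : ∀ c → encode c ∈ endpoints (pendantMatching x₀)
    covered (inj₁ v) = proj₁ (∈-endpoints-map hub (pendant x₀) (∈-allFin v))
    covered (inj₂ (v , x)) rewrite only x = proj₂ (∈-endpoints-map hub (pendant x₀) (∈-allFin v))

owner-cliqueCover : ∀ H n → IsCliqueCover (corona H (K n)) (owner H (K n) ∘ decode H (K n))
owner-cliqueCover H n {u} {v} sameOwner u≢v =
  sameOwner⇒CAdj (decode H (K n) u) (decode H (K n) v) sameOwner (u≢v ∘ decode-injective H (K n))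
  where
  sameOwner⇒CAdj : ∀ c d → owner H (K n) c ≡ owner H (K n) d → c ≢ d → CAdj H (K n) c d
  sameOwner⇒CAdj (inj₁ _) (inj₁ _) refl      c≢d = ⊥-elim (c≢d refl)
  sameOwner⇒CAdj (inj₁ _) (inj₂ _) sameOwner _   = sameOwner
  sameOwner⇒CAdj (inj₂ _) (inj₁ _) sameOwner _   = sameOwner
  sameOwner⇒CAdj (inj₂ _) (inj₂ _) refl      c≢d = refl , λ { refl → c≢d refl }

corona-K-koenigEgervary⇒n≤1 : ∀ H n → 0 < V H → IsKoenigEgervary (corona H (K n)) → n ≤ 1
corona-K-koenigEgervary⇒n≤1 H n 0<h ke =
  *-cancelˡ-≤ (V H) {{>-nonZero 0<h}} (≤-trans hn≤h (≤-reflexive (sym (*-identityʳ (V H)))))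
  where
  hn≤h : V H * n ≤ V H
  hn≤h = +-cancelˡ-≤ (V H) (V H * n) (V H)
    (koenigEgervary⇒order≤2k (corona H (K n)) (owner-cliqueCover H n) ke)

corona-K1-koenigEgervary : ∀ H → IsKoenigEgervary (corona H (K 1))
corona-K1-koenigEgervary H = V H , V H , α≡h , μ≡h , cong (V H +_) (sym (*-identityʳ (V H)))
  where
  G : Graph
  G = corona H (K 1)

  α≡h : IsIndependenceNumber G (V H)
  α≡h = isIndependenceNumber G (owner-cliqueCover H 1)
    (pendants-independent H (K 1) fzero) (length-pendants H (K 1) fzero)

  |M|≡h : length (pendantMatching H (K 1) fzero) ≡ V H
  |M|≡h = length-pendantMatching H (K 1) fzero

  μ≡h : IsMatchingNumber G (V H)
  μ≡h = subst (IsMatchingNumber G) |M|≡h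
    (isMatchingNumber G (pendantMatching-isMatching H (K 1) fzero)
      (cong₂ _+_ |M|≡h (trans |M|≡h (sym (*-identityʳ (V H))))))

corona-K1-perfectMatching : ∀ H → HasPerfectMatching (corona H (K 1))
corona-K1-perfectMatching H =
  pendantMatching H (K 1) fzero , pendantMatching-isMatching H (K 1) fzero ,
  pendantMatching-perfect H (K 1) λ { fzero → refl }

corollary2p8 : (H : Graph) (n : ℕ) → 0 < V H → 1 ≤ n →
    (IsKoenigEgervary (corona H (K n)) × HasPerfectMatching (corona H (K n))) ⇔ (n ≡ 1)
corollary2p8 H n 0<h 1≤n = mk⇔
  (λ (ke , _) → ≤-antisym (corona-K-koenigEgervary⇒n≤1 H n 0<h ke) 1≤n)
  (λ { refl → corona-K1-koenigEgervary H , corona-K1-perfectMatching H })
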